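{- Let $T=(V,E)$ be a tree rooted at a vertex $r$ (denote the rooted tree $T_r$), let $k\ge1$ be an integer and let $B\subseteq V$. Let $u\in V$ be such that the subtree $T_u$ of $T_r$ rooted at $u$ has height exactly $k$. If there exists a leaf $v\in B$ of $T_r$ lying in $T_u$ at depth $k$ (i.e., $d_{T_r}(u,v)=k$), then $\Gamma_V(B)=\Gamma_{V'}(B')+1$, where $B'=B\setminus\mathcal{N}_k(u)$ and $V'$ is obtained from $V$ by removing all vertices of $T_u$.
   Context: All distances $d_{T_r}(x,y)$ are hop-distances in the tree $T$. $T_u$ consists of $u$ and all its descendants in $T_r$; its height is $\max_{w\in T_u} d_{T_r}(u,w)$. A leaf of $T_r$ is a vertex with no children. $\mathcal{N}_k(u)=\{w\in V: d_{T_r}(u,w)\le k\}$. For $W\subseteq V$ and $A\subseteq V$, a partial $k$-hop dominating set of $A$ from $W$ is a set $D\subseteq W$ such that for every $a\in A$ there is $x\in D$ with $d_{T_r}(x,a)\le k$; $\Gamma_W(A)$ denotes the minimum cardinality of such a set $D$. -}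

module Defs where

open import Data.Nat using (ℕ; zero; suc; _≤_; _<_)
open import Data.Fin using (Fin; toℕ)
import Data.Fin as F
open import Data.Fin.Subset using (Subset; _∈_; _⊆_; ∣_∣)
open import Data.Product using (Σ; ∃; _×_; _,_)
open import Relation.Binary.PropositionalEquality using (_≡_; _≢_)
open import Relation.Nullary using (¬_)

-- A rooted tree on the vertex set Fin (suc n) with root F.zero is given by a
-- parent function `par` such that every non-root vertex has a parent with a
-- strictly smaller label (value of par at the root is irrelevant).
-- Every rooted tree is isomorphic to one of this form (label in BFS order).
IsRootedTree : {n : ℕ} → (Fin (suc n) → Fin (suc n)) → Set
IsRootedTree par = ∀ i → i ≢ F.zero → toℕ (par i) < toℕ i

module _ {n : ℕ} (par : Fin (suc n) → Fin (suc n)) where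

  V : Set
  V = Fin (suc n)

  data Edge : V → V → Set where
    up   : ∀ {x} → x ≢ F.zero → Edge x (par x)
    down : ∀ {x} → x ≢ F.zero → Edge (par x) x

  data Walk : V → V → ℕ → Set where
    nil  : ∀ {x} → Walk x x 0
    cons : ∀ {x y z m} → Edge x y → Walk y z m → Walk x z (suc m)

  Dist≤ : V → V → ℕ → Set
  Dist≤ x y k = Σ ℕ λ m → m ≤ k × Walk x y m

  DistEq : V → V → ℕ → Set
  DistEq x y k = Dist≤ x y k × (∀ m → m < k → ¬ Dist≤ x y m)

  data InSubtree (u : V) : V → Set where
    here : InSubtree u u
    step : ∀ {w} → w ≢ F.zero → InSubtree u (par w) → InSubtree u w

  HeightEq : V → ℕ → Set
  HeightEq u k = (∀ w → InSubtree u w → Dist≤ u w k)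
               × (Σ V λ w → InSubtree u w × DistEq u w k)

  IsLeaf : V → Set
  IsLeaf v = ∀ w → w ≢ F.zero → par w ≢ v

  IsPartialDom : ℕ → Subset (suc n) → Subset (suc n) → Subset (suc n) → Set
  IsPartialDom k W A D = D ⊆ W × (∀ a → a ∈ A → Σ V λ x → x ∈ D × Dist≤ x a k)

  IsGamma : ℕ → Subset (suc n) → Subset (suc n) → ℕ → Set
  IsGamma k W A m = (Σ (Subset (suc n)) λ D → IsPartialDom k W A D × ∣ D ∣ ≡ m)
                  × (∀ D → IsPartialDom k W A D → m ≤ ∣ D ∣)

-- Every vertex of T_u lies within k of u, so u alone dominates B ∩ N_k(u).  Conversely,
-- a walk leaving T_u must pass through u, so a dominator inside T_u of a vertex outside
-- T_u can be replaced by u; hence the part outside T_u of any dominating set of B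
-- dominates B'.  That part is strictly smaller, because the vertex v at distance exactly
-- k from u can only be dominated from inside T_u.
module Submission where

open import Defs
open import Data.Nat using (ℕ; zero; suc; _+_; _≤_; _<_; _≥_; z≤n; s≤s; _<?_)
open import Data.Nat.Properties using (≤-refl; ≤-trans; <-≤-trans; ≮⇒≥; +-suc; +-identityʳ; m<m+n; m+n≤o⇒n≤o)
open import Data.Fin using (Fin)
import Data.Fin as F
open import Data.Fin.Properties using (any?; all?) renaming (_≟_ to _≟F_)
open import Data.Fin.Subset using (Subset; _∈_; _∉_; _⊆_; _⊂_; _∪_; _∩_; ⁅_⁆; ∣_∣; ⊤; inside; outside)
open import Data.Fin.Subset.Properties using (_∈?_; _⊆?_; anySubset?; ∈⊤; x∈⁅x⁆; x∈p∪q⁺; x∈p∩q⁺; x∈p∩q⁻; p∩q⊆q; p⊂q⇒∣p∣<∣q∣; ∪-identityʳ)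
open import Data.Vec using (_∷_; here; there)
open import Data.Product using (Σ; ∃; _×_; _,_; proj₁; proj₂)
open import Data.Sum using (_⊎_; inj₁; inj₂)
open import Data.Empty using (⊥-elim)
open import Function using (_∘′_)
open import Function.Bundles using (_⇔_; module Equivalence)
open import Relation.Nullary using (¬_; Dec; yes; no)
open import Relation.Nullary.Decidable using (¬?; _×-dec_; _⊎-dec_; _→-dec_; map′)
open import Relation.Unary using (Decidable)
open import Relation.Binary.PropositionalEquality using (_≡_; _≢_; refl; cong; subst)

open Equivalence using (to; from)

x∉p⇒∣p∪⁅x⁆∣≡1+∣p∣ : ∀ {m} (x : Fin m) (p : Subset m) → x ∉ p → ∣ p ∪ ⁅ x ⁆ ∣ ≡ suc ∣ p ∣
x∉p⇒∣p∪⁅x⁆∣≡1+∣p∣ F.zero    (outside ∷ p) x∉p rewrite ∪-identityʳ p = refl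
x∉p⇒∣p∪⁅x⁆∣≡1+∣p∣ F.zero    (inside ∷ p)  x∉p = ⊥-elim (x∉p here)
x∉p⇒∣p∪⁅x⁆∣≡1+∣p∣ (F.suc x) (outside ∷ p) x∉p = x∉p⇒∣p∪⁅x⁆∣≡1+∣p∣ x p (x∉p ∘′ there)
x∉p⇒∣p∪⁅x⁆∣≡1+∣p∣ (F.suc x) (inside ∷ p)  x∉p = cong suc (x∉p⇒∣p∪⁅x⁆∣≡1+∣p∣ x p (x∉p ∘′ there))

minimumCardinality : ∀ {m} {P : Subset m → Set} → Decidable P → ∀ {D} → P D →
                     Σ (Subset m) λ D₀ → P D₀ × (∀ E → P E → ∣ D₀ ∣ ≤ ∣ E ∣)
minimumCardinality {m} {P} P? {D} pD = descend (suc ∣ D ∣) D pD ≤-refl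
  where
  descend : (bound : ℕ) (D : Subset m) → P D → ∣ D ∣ < bound →
            Σ (Subset m) λ D₀ → P D₀ × (∀ E → P E → ∣ D₀ ∣ ≤ ∣ E ∣)
  descend (suc bound) D pD (s≤s ∣D∣≤bound) with anySubset? (λ E → P? E ×-dec (∣ E ∣ <? ∣ D ∣))
  ... | yes (E , pE , ∣E∣<∣D∣) = descend bound E pE (<-≤-trans ∣E∣<∣D∣ ∣D∣≤bound)
  ... | no noSmaller = D , pD , λ E pE → ≮⇒≥ λ ∣E∣<∣D∣ → noSmaller (E , pE , ∣E∣<∣D∣)

module _ {n : ℕ} (par : Fin (suc n) → Fin (suc n)) where

  Edge-sym : ∀ {x y} → Edge par x y → Edge par y x
  Edge-sym (up x≢0)   = down x≢0
  Edge-sym (down x≢0) = up x≢0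

  Walk-reverse : ∀ {x y m} → Walk par x y m → Walk par y x m
  Walk-reverse {m = m} w = subst (Walk par _ _) (+-identityʳ m) (go w nil)
    where
    go : ∀ {x y z i j} → Walk par x y i → Walk par x z j → Walk par y z (i + j)
    go nil acc = acc
    go {i = suc i} {j = j} (cons e w) acc =
      subst (Walk par _ _) (+-suc i j) (go w (cons (Edge-sym e) acc))

  Dist≤-sym : ∀ {x y k} → Dist≤ par x y k → Dist≤ par y x k
  Dist≤-sym (m , m≤k , w) = m , m≤k , Walk-reverse w

  InSubtree-par : ∀ {u x} → InSubtree par u x → x ≢ u → InSubtree par u (par x)
  InSubtree-par here       x≢u = ⊥-elim (x≢u refl)
  InSubtree-par (step _ h) _   = h

  -- The only edge out of T_u is the one from u to its parent.
  Walk-leavesSubtreeVia-root : ∀ {u x y m} → InSubtree par u x → ¬ InSubtree par u y →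
    Walk par x y m → Σ ℕ λ i → Σ ℕ λ j → (i + suc j ≡ m) × Walk par x u i × Walk par u y (suc j)
  Walk-leavesSubtreeVia-root x∈Tᵤ y∉Tᵤ nil = ⊥-elim (y∉Tᵤ x∈Tᵤ)
  Walk-leavesSubtreeVia-root {u} {x} x∈Tᵤ y∉Tᵤ (cons (up x≢0) w) with x ≟F u
  ... | yes refl = 0 , _ , refl , nil , cons (up x≢0) w
  ... | no x≢u with Walk-leavesSubtreeVia-root (InSubtree-par x∈Tᵤ x≢u) y∉Tᵤ w
  ...   | i , j , eq , wₓᵤ , wᵤᵧ = suc i , j , cong suc eq , cons (up x≢0) wₓᵤ , wᵤᵧ
  Walk-leavesSubtreeVia-root x∈Tᵤ y∉Tᵤ (cons (down y≢0) w)
    with Walk-leavesSubtreeVia-root (step y≢0 x∈Tᵤ) y∉Tᵤ w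
  ... | i , j , eq , wₓᵤ , wᵤᵧ = suc i , j , cong suc eq , cons (down y≢0) wₓᵤ , wᵤᵧ

  Dist≤-leavingSubtree-fromRoot : ∀ {u x y k} → InSubtree par u x → ¬ InSubtree par u y →
                                  Dist≤ par x y k → Dist≤ par u y k
  Dist≤-leavingSubtree-fromRoot x∈Tᵤ y∉Tᵤ (_ , m≤k , w)
    with Walk-leavesSubtreeVia-root x∈Tᵤ y∉Tᵤ w
  ... | i , j , refl , _ , wᵤᵧ = suc j , m+n≤o⇒n≤o i m≤k , wᵤᵧ

  Dist≤-leavingSubtree-toRoot : ∀ {u x y k} → InSubtree par u x → ¬ InSubtree par u y →
                                Dist≤ par x y k → ∃ λ i → i < k × Walk par x u i
  Dist≤-leavingSubtree-toRoot x∈Tᵤ y∉Tᵤ (_ , m≤k , w)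
    with Walk-leavesSubtreeVia-root x∈Tᵤ y∉Tᵤ w
  ... | i , j , refl , wₓᵤ , _ = i , <-≤-trans (m<m+n i (s≤s z≤n)) m≤k , wₓᵤ

  Edge? : ∀ x y → Dec (Edge par x y)
  Edge? x y = map′ fromSum toSum
    ((¬? (x ≟F F.zero) ×-dec (y ≟F par x)) ⊎-dec (¬? (y ≟F F.zero) ×-dec (x ≟F par y)))
    where
    EdgeCases : Set
    EdgeCases = (x ≢ F.zero × y ≡ par x) ⊎ (y ≢ F.zero × x ≡ par y)
    fromSum : EdgeCases → Edge par x y
    fromSum (inj₁ (x≢0 , refl)) = up x≢0
    fromSum (inj₂ (y≢0 , refl)) = down y≢0
    toSum : Edge par x y → EdgeCases
    toSum (up x≢0)   = inj₁ (x≢0 , refl)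
    toSum (down y≢0) = inj₂ (y≢0 , refl)

  Dist≤? : ∀ k x y → Dec (Dist≤ par x y k)
  Dist≤? k x y with x ≟F y
  ... | yes refl = yes (0 , z≤n , nil)
  Dist≤? zero    x y | no x≢y = no λ { (0 , _ , nil) → x≢y refl }
  Dist≤? (suc k) x y | no x≢y = map′ viaNeighbour firstStep (any? λ z → Edge? x z ×-dec Dist≤? k z y)
    where
    viaNeighbour : ∃ (λ z → Edge par x z × Dist≤ par z y k) → Dist≤ par x y (suc k)
    viaNeighbour (_ , e , m , m≤k , w) = suc m , s≤s m≤k , cons e w
    firstStep : Dist≤ par x y (suc k) → ∃ (λ z → Edge par x z × Dist≤ par z y k)
    firstStep (0 , _ , nil) = ⊥-elim (x≢y refl)
    firstStep (suc m , s≤s m≤k , cons e w) = _ , e , m , m≤k , w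

  IsPartialDom? : ∀ k W A → Decidable (IsPartialDom par k W A)
  IsPartialDom? k W A D =
    (D ⊆? W) ×-dec all? (λ a → (a ∈? A) →-dec any? (λ x → (x ∈? D) ×-dec Dist≤? k x a))

  IsGamma-exists : ∀ {k W A D} → IsPartialDom par k W A D → ∃ (IsGamma par k W A)
  IsGamma-exists {k} {W} {A} dom with minimumCardinality (IsPartialDom? k W A) dom
  ... | D₀ , dom₀ , minimal = ∣ D₀ ∣ , (D₀ , dom₀ , refl) , minimal

  module Pruning {k : ℕ} {B B' V' : Subset (suc n)} {u : Fin (suc n)}
    (T_u-withinReach : ∀ w → InSubtree par u w → Dist≤ par u w k)
    (B'-def : ∀ a → (a ∈ B') ⇔ (a ∈ B × ¬ Dist≤ par u a k))
    (V'-def : ∀ w → (w ∈ V') ⇔ (¬ InSubtree par u w)) where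

    B'⊆V' : B' ⊆ V'
    B'⊆V' {b} b∈B' = from (V'-def b) λ b∈Tᵤ → proj₂ (to (B'-def b) b∈B') (T_u-withinReach b b∈Tᵤ)

    u∉V' : u ∉ V'
    u∉V' u∈V' = to (V'-def u) u∈V' here

    extend-dominates : ∀ {D} → IsPartialDom par k V' B' D → IsPartialDom par k ⊤ B (D ∪ ⁅ u ⁆)
    extend-dominates {D} (_ , dom) = (λ _ → ∈⊤) , dominate
      where
      dominate : ∀ a → a ∈ B → Σ (Fin (suc n)) λ x → x ∈ D ∪ ⁅ u ⁆ × Dist≤ par x a k
      dominate a a∈B with Dist≤? k u a
      ... | yes d = u , x∈p∪q⁺ (inj₂ (x∈⁅x⁆ u)) , d
      ... | no ¬d with dom a (from (B'-def a) (a∈B , ¬d))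
      ...   | x , x∈D , d = x , x∈p∪q⁺ (inj₁ x∈D) , d

    restrict-dominates : ∀ {D} → IsPartialDom par k ⊤ B D → IsPartialDom par k V' B' (D ∩ V')
    restrict-dominates {D} (_ , dom) = p∩q⊆q D V' , dominate
      where
      dominate : ∀ b → b ∈ B' → Σ (Fin (suc n)) λ x → x ∈ D ∩ V' × Dist≤ par x b k
      dominate b b∈B' with to (B'-def b) b∈B'
      ... | b∈B , ¬d with dom b b∈B
      ...   | x , x∈D , d with x ∈? V'
      ...     | yes x∈V' = x , x∈p∩q⁺ (x∈D , x∈V') , d
      ...     | no x∉V' = ⊥-elim (x∉V' (from (V'-def x) λ x∈Tᵤ →
                  ¬d (Dist≤-leavingSubtree-fromRoot x∈Tᵤ (to (V'-def b) (B'⊆V' b∈B')) d)))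

    restrict-proper : ∀ {v D} → v ∈ B → InSubtree par u v → DistEq par u v k →
                      IsPartialDom par k ⊤ B D → D ∩ V' ⊂ D
    restrict-proper {v} {D} v∈B v∈Tᵤ (_ , farthest) (_ , dom) with dom v v∈B
    ... | x , x∈D , d = (λ y∈D∩V' → proj₁ (x∈p∩q⁻ D V' y∈D∩V')) , x , x∈D , x∉D∩V'
      where
      x∉D∩V' : x ∉ D ∩ V'
      x∉D∩V' x∈D∩V' with Dist≤-leavingSubtree-toRoot v∈Tᵤ (to (V'-def x) (proj₂ (x∈p∩q⁻ D V' x∈D∩V'))) (Dist≤-sym d)
      ... | i , i<k , wᵥᵤ = farthest i i<k (i , ≤-refl , Walk-reverse wᵥᵤ)

    B'-dominatesItself : IsPartialDom par k V' B' B'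
    B'-dominatesItself = B'⊆V' , λ b b∈B' → b , b∈B' , 0 , z≤n , nil

    IsGamma-suc : ∀ {v m} → v ∈ B → InSubtree par u v → DistEq par u v k →
                  IsGamma par k V' B' m → IsGamma par k ⊤ B (suc m)
    IsGamma-suc v∈B v∈Tᵤ v-farthest ((D₀ , dom₀ , refl) , minimal) =
      (D₀ ∪ ⁅ u ⁆ , extend-dominates dom₀ , x∉p⇒∣p∪⁅x⁆∣≡1+∣p∣ u D₀ (u∉V' ∘′ proj₁ dom₀)) ,
      λ D dom → ≤-trans (s≤s (minimal (D ∩ V') (restrict-dominates dom)))
                        (p⊂q⇒∣p∣<∣q∣ (restrict-proper v∈B v∈Tᵤ v-farthest dom))

mainTheorem6 : (n : ℕ) (par : Fin (suc n) → Fin (suc n)) → IsRootedTree par →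
    (k : ℕ) → k ≥ 1 → (B : Subset (suc n)) → (u : Fin (suc n)) →
    HeightEq par u k →
    (v : Fin (suc n)) → v ∈ B → IsLeaf par v → InSubtree par u v → DistEq par u v k →
    (B' V' : Subset (suc n)) →
    (∀ a → (a ∈ B') ⇔ (a ∈ B × ¬ Dist≤ par u a k)) →
    (∀ w → (w ∈ V') ⇔ (¬ InSubtree par u w)) →
    Σ ℕ λ m → IsGamma par k V' B' m × IsGamma par k ⊤ B (suc m)
mainTheorem6 n par _ k _ B u (T_u-withinReach , _) v v∈B _ v∈Tᵤ v-farthest B' V' B'-def V'-def =
  let m , Γ' = IsGamma-exists par B'-dominatesItself
  in  m , Γ' , IsGamma-suc v∈B v∈Tᵤ v-farthest Γ'
  where open Pruning par T_u-withinReach B'-def V'-def
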